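{- Let $D=([n],A)$ be an acyclic digraph. If $\mathcal{W}(D)=\emptyset$, then $\Psi(D,x)=\Omega(\bar D,x)$.
   Context: For distinct vertices $a,b$, write $a\prec_D b$ if $D$ has a directed path from $a$ to $b$, and $a\not\approx_D b$ if neither $a\prec_D b$ nor $b\prec_D a$. $\mathcal{W}(D)$ is the set of $3$-element subsets $\{a,b,c\}\subseteq[n]$ with $a<b<c$ such that $(c,a)\in A$, $a\not\approx_D b$ and $c\not\approx_D b$. $\mathcal{OP}(D)$ is the set of orderings $(u_1,\dots,u_n)$ of $[n]$ such that $(u_i,u_j)\in A$ implies $i<j$. For $a,b\in[n]$, $\delta_D(a,b)=1$ if $a<b$ or $(a,b)\in A$, and $0$ otherwise; for $\pi=(a_1,\dots,a_n)$, $\delta_D(\pi)=\sum_{i=1}^{n-1}\delta_D(a_i,a_{i+1})$. $\Psi(D,x)=\sum_{\pi\in\mathcal{OP}(D)}\binom{x+\delta_D(\pi)}{n}$, where $\binom{x+k}{n}=(x+k)(x+k-1)\cdots(x+k-n+1)/n!$. $\bar D$ is the poset on $[n]$ which is the reflexive transitive closure of $D$, and $\Omega(P,x)$ is the order polynomial of a poset $P$: its value at a positive integer $m$ is the number of order-preserving maps $P\to[m]$ ($u\preceq v\Rightarrow\sigma(u)\le\sigma(v)$). -}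

module Defs where

open import Data.Nat using (ℕ; zero; suc; _+_; _<ᵇ_)
open import Data.Nat.Combinatorics using (_C_)
open import Data.Bool using (Bool; true; false; if_then_else_; _∨_)
open import Data.Fin using (Fin; toℕ; _<_; _≤_)
open import Data.List using (List; []; _∷_; map; concatMap; allFin)
open import Data.Vec using (Vec; []; _∷_; lookup)
open import Data.Product using (_×_; Σ; ∃; ∃-syntax)
open import Relation.Nullary using (¬_)
open import Relation.Binary.PropositionalEquality using (_≡_)
open import Relation.Binary.Construct.Closure.Transitive using (TransClosure)
open import Relation.Binary.Construct.Closure.ReflexiveTransitive using (Star)

-- A digraph D = ([n], A) on vertex set Fin n (vertex i stands for i+1 ∈ [n]);
-- A is given by its (decidable) adjacency: (a,b) ∈ A  iff  A a b ≡ true.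
Digraph : ℕ → Set
Digraph n = Fin n → Fin n → Bool

module _ {n : ℕ} (D : Digraph n) where

  Arc : Fin n → Fin n → Set
  Arc a b = D a b ≡ true

  Prec : Fin n → Fin n → Set
  Prec = TransClosure Arc

  Incomp : Fin n → Fin n → Set
  Incomp a b = ¬ Prec a b × ¬ Prec b a

  Acyclic : Set
  Acyclic = ∀ a → ¬ Prec a a

  InW : Fin n → Fin n → Fin n → Set
  InW a b c = (a < b) × (b < c) × Arc c a × Incomp a b × Incomp c b

  WEmpty : Set
  WEmpty = ∀ a b c → ¬ InW a b c

  IsOrdering : Vec (Fin n) n → Set
  IsOrdering π = ∀ i j → lookup π i ≡ lookup π j → i ≡ j

  IsOP : Vec (Fin n) n → Set
  IsOP π = IsOrdering π × (∀ i j → Arc (lookup π i) (lookup π j) → i < j)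

  δ : Fin n → Fin n → ℕ
  δ a b = if (toℕ a <ᵇ toℕ b) ∨ D a b then 1 else 0

  δList : List (Fin n) → ℕ
  δList [] = 0
  δList (a ∷ []) = 0
  δList (a ∷ b ∷ rest) = δ a b + δList (b ∷ rest)

  δVec : ∀ {k} → Vec (Fin n) k → ℕ
  δVec v = δList (Data.Vec.toList v)

  -- the poset D̄: u ⪯ v iff reflexive-transitive closure of the arcs
  Below : Fin n → Fin n → Set
  Below = Star Arc

  -- σ : D̄ → [m] order preserving (σ given as a vector of values in Fin m ≅ [m])
  OrderPreserving : {m : ℕ} → Vec (Fin m) n → Set
  OrderPreserving σ = ∀ u v → Below u v → lookup σ u ≤ lookup σ v

allVecs : (k n : ℕ) → List (Vec (Fin k) n)
allVecs k zero = [] ∷ []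
allVecs k (suc n) = concatMap (λ x → map (x ∷_) (allVecs k n)) (allFin k)

data WSum {A : Set} (P : A → Set) (w : A → ℕ) : List A → ℕ → Set where
  nil  : WSum P w [] 0
  keep : ∀ {x xs s} → P x → WSum P w xs s → WSum P w (x ∷ xs) (w x + s)
  skip : ∀ {x xs s} → ¬ P x → WSum P w xs s → WSum P w (x ∷ xs) s

PsiIs : ∀ {n} → Digraph n → ℕ → ℕ → Set
PsiIs {n} D m s = WSum (IsOP D) (λ π → (m + δVec D π) C n) (allVecs n n) s

OmegaIs : ∀ {n} → Digraph n → ℕ → ℕ → Set
OmegaIs {n} D m s = WSum (OrderPreserving D {m}) (λ _ → 1) (allVecs m n) s

-- Break ties in the reachability order of D by the vertex numbering: u ⊲ v if u reaches v, or
-- if they are incomparable and u < v. This is a strict total order, and W(D) = ∅ is exactly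
-- what makes it transitive. Given an order-preserving σ : D̄ → [m], listing the vertices by
-- (σ, ⊲) yields the unique π ∈ OP(D) along which σ is compatible: weakly increasing, and
-- strictly so at every step with δ = 0. Thus order-preserving maps correspond to pairs (π, f)
-- with π ∈ OP(D) and f : [n] → [m] weakly increasing with forced strict ascents at the
-- n - 1 - δ(π) steps where δ = 0, and for fixed π there are binom(m + δ(π), n) such f.

module Submission where

open import Defs
open import Data.Nat using (ℕ; _≤_)
open import Data.Product using (Σ; _×_)

open import Data.Nat using (zero; suc; _+_; _∸_; _≤?_; z≤n; s≤s; pred; _<ᵇ_) renaming (_<_ to _<ℕ_)
import Data.Nat.Properties as ℕ
open import Data.Nat.ListAction using (sum)
open import Data.Nat.Combinatorics using (_C_; nC1≡n; nCk+nC[k+1]≡[n+1]C[k+1]; k>n⇒nCk≡0)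
open import Algebra.Properties.CommutativeSemigroup ℕ.+-commutativeSemigroup using (interchange)
open import Data.Bool using (true; false; _∨_)
import Data.Bool.Properties as Bool
open import Data.Fin using (Fin; toℕ; fromℕ<; _<_; punchOut) renaming (zero to fzero; suc to fsuc)
import Data.Fin.Properties as Fin
open import Data.Fin.Properties using (_≟_)
open import Data.List using (List; []; _∷_; length; map; concatMap; allFin)
import Data.List as List
import Data.List.Properties as Listₚ
open import Data.List.Membership.Propositional using (_∈_; _∉_)
import Data.List.Membership.Propositional.Properties as Membership
open import Data.List.Relation.Unary.All as All using (All; []; _∷_)
open import Data.List.Relation.Unary.Any using (here; there)
open import Data.List.Relation.Unary.AllPairs using (AllPairs; []; _∷_)
open import Data.List.Relation.Unary.Linked using (Linked; []; [-]; _∷_)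
open import Data.List.Relation.Unary.Linked.Properties using (Linked⇒AllPairs)
import Data.List.Relation.Unary.Unique.Propositional.Properties as Unique
open import Data.Vec using (Vec; []; _∷_; lookup; toList; tabulate; head)
import Data.Vec as Vec
import Data.Vec.Properties as Vecₚ
open import Data.Vec.Membership.Propositional.Properties using (∈-lookup; ∈-toList⁺; ∈-toList⁻)
import Data.Vec.Relation.Unary.Any as VecAny
open import Data.Vec.Relation.Unary.Any.Properties using (lookup-index)
open import Data.Product using (∃; _,_; proj₁; proj₂)
open import Data.Sum using (_⊎_; inj₁; inj₂)
open import Data.Unit using (⊤; tt)
open import Data.Empty using (⊥; ⊥-elim)
open import Function using (_∘_; id; Equivalence)
open import Level using (0ℓ)
open import Relation.Nullary using (¬_; Dec; yes; no; _×-dec_; _⊎-dec_; _→-dec_; ¬?)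
open import Relation.Nullary.Decidable using (map′)
open import Relation.Binary using (Rel; Transitive; Decidable; tri<; tri≈; tri>)
open import Relation.Binary.PropositionalEquality hiding ([_])
open import Relation.Binary.Construct.Closure.Transitive using ([_]; _∷_; _++_; _∷ʳ_)
open import Relation.Binary.Construct.Closure.ReflexiveTransitive using (Star; ε; _◅_)

private
  variable
    A B : Set
    k : ℕ

-- Finite sums and Iverson brackets

∑ : {A : Set} → List A → (A → ℕ) → ℕ
∑ [] f = 0
∑ (x ∷ xs) f = f x + ∑ xs f

infix 5 ∑
syntax ∑ xs (λ x → e) = ∑[ x ∈ xs ] e

∑-cong : ∀ (xs : List A) {f g : A → ℕ} → (∀ x → f x ≡ g x) → ∑ xs f ≡ ∑ xs g
∑-cong [] e = refl
∑-cong (x ∷ xs) e = cong₂ _+_ (e x) (∑-cong xs e)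

∑-zero : ∀ (xs : List A) {f : A → ℕ} → (∀ x → f x ≡ 0) → ∑ xs f ≡ 0
∑-zero [] e = refl
∑-zero (x ∷ xs) e rewrite e x = ∑-zero xs e

∑-++ : ∀ (xs ys : List A) (f : A → ℕ) → ∑ (xs List.++ ys) f ≡ ∑ xs f + ∑ ys f
∑-++ [] ys f = refl
∑-++ (x ∷ xs) ys f = trans (cong (f x +_) (∑-++ xs ys f)) (sym (ℕ.+-assoc (f x) _ _))

∑-+ : ∀ (xs : List A) (f g : A → ℕ) → ∑[ x ∈ xs ] (f x + g x) ≡ ∑ xs f + ∑ xs g
∑-+ [] f g = refl
∑-+ (x ∷ xs) f g =
  trans (cong (f x + g x +_) (∑-+ xs f g)) (interchange (f x) (g x) (∑ xs f) (∑ xs g))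

∑-swap : (xs : List A) (ys : List B) (f : A → B → ℕ) →
         ∑[ x ∈ xs ] ∑[ y ∈ ys ] f x y ≡ ∑[ y ∈ ys ] ∑[ x ∈ xs ] f x y
∑-swap [] ys f = sym (∑-zero ys (λ _ → refl))
∑-swap (x ∷ xs) ys f = trans (cong (∑ ys (f x) +_) (∑-swap xs ys f)) (sym (∑-+ ys (f x) _))

∑-map : (h : A → B) (xs : List A) (f : B → ℕ) → ∑ (map h xs) f ≡ ∑ xs (f ∘ h)
∑-map h [] f = refl
∑-map h (x ∷ xs) f = cong (f (h x) +_) (∑-map h xs f)

∑-concatMap : (h : A → List B) (xs : List A) (f : B → ℕ) →
              ∑ (concatMap h xs) f ≡ ∑[ x ∈ xs ] ∑ (h x) f
∑-concatMap h [] f = refl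
∑-concatMap h (x ∷ xs) f =
  trans (∑-++ (h x) (concatMap h xs) f) (cong (∑ (h x) f +_) (∑-concatMap h xs f))

[_]·_ : {P : Set} → Dec P → ℕ → ℕ
[ yes _ ]· k = k
[ no _ ]· k = 0

infix 8 [_]·_

module _ {P Q : Set} where

  []·-⇔ : ∀ (p : Dec P) (q : Dec Q) k → (P → Q) → (Q → P) → [ p ]· k ≡ [ q ]· k
  []·-⇔ (yes _) (yes _) k f g = refl
  []·-⇔ (yes x) (no y) k f g = ⊥-elim (y (f x))
  []·-⇔ (no x) (yes y) k f g = ⊥-elim (x (g y))
  []·-⇔ (no _) (no _) k f g = refl

  []·-× : ∀ {R : Set} (p : Dec P) (q : Dec Q) (r : Dec R) k →
          (R → P × Q) → (P × Q → R) → [ p ]· [ q ]· k ≡ [ r ]· k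
  []·-× (yes a) (yes b) (yes c) k f g = refl
  []·-× (yes a) (yes b) (no c) k f g = ⊥-elim (c (g (a , b)))
  []·-× (yes a) (no b) (yes c) k f g = ⊥-elim (b (proj₂ (f c)))
  []·-× (yes a) (no b) (no c) k f g = refl
  []·-× (no a) q (yes c) k f g = ⊥-elim (a (proj₁ (f c)))
  []·-× (no a) q (no c) k f g = refl

∑-[]· : ∀ {P : Set} (xs : List A) (p : Dec P) (f : A → ℕ) →
        ∑[ x ∈ xs ] [ p ]· f x ≡ [ p ]· ∑ xs f
∑-[]· xs (yes _) f = refl
∑-[]· xs (no _) f = ∑-zero xs (λ _ → refl)

∑-[]·-⊥ : ∀ {P : A → Set} (xs : List A) (p : ∀ x → Dec (P x)) (f : A → ℕ) →
          (∀ x → ¬ P x) → ∑[ x ∈ xs ] [ p x ]· f x ≡ 0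
∑-[]·-⊥ xs p f ¬P = ∑-zero xs λ x → []·-⇔ (p x) (no (λ ())) (f x) (¬P x) (λ ())

WSum-∑ : ∀ {P : A → Set} (P? : ∀ x → Dec (P x)) (w : A → ℕ) (xs : List A) →
         WSum P w xs (∑[ x ∈ xs ] [ P? x ]· w x)
WSum-∑ P? w [] = nil
WSum-∑ P? w (x ∷ xs) with P? x
... | yes p = keep p (WSum-∑ P? w xs)
... | no ¬p = skip ¬p (WSum-∑ P? w xs)

∑-allFin-suc : ∀ k (h : Fin (suc k) → ℕ) → ∑ (allFin (suc k)) h ≡ h fzero + ∑ (allFin k) (h ∘ fsuc)
∑-allFin-suc k h = cong (h fzero +_) (begin
  ∑ (List.tabulate fsuc) h   ≡⟨ cong (λ xs → ∑ xs h) (sym (Listₚ.map-tabulate id fsuc)) ⟩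
  ∑ (map fsuc (allFin k)) h  ≡⟨ ∑-map fsuc (allFin k) h ⟩
  ∑ (allFin k) (h ∘ fsuc)    ∎)
  where open ≡-Reasoning

∑-allFin-point : ∀ {k} (y : Fin k) (d : ∀ x → Dec (x ≡ y)) (h : Fin k → ℕ) →
                 ∑[ x ∈ allFin k ] [ d x ]· h x ≡ h y
∑-allFin-point {suc k} y d h = trans (∑-allFin-suc k (λ x → [ d x ]· h x)) (split y d (d fzero))
  where
  split : ∀ y (d : ∀ x → Dec (x ≡ y)) (d₀ : Dec (fzero ≡ y)) →
          [ d₀ ]· h fzero + (∑[ x ∈ allFin k ] [ d (fsuc x) ]· h (fsuc x)) ≡ h y
  split fzero d (yes _) =
    trans (cong (h fzero +_) (∑-[]·-⊥ (allFin k) (d ∘ fsuc) (h ∘ fsuc) λ _ ())) (ℕ.+-identityʳ _)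
  split fzero d (no 0≢0) = ⊥-elim (0≢0 refl)
  split (fsuc y) d (no _) =
    trans (∑-cong (allFin k) λ x → []·-⇔ (d (fsuc x)) (x ≟ y) _ Fin.suc-injective (cong fsuc))
          (∑-allFin-point y (_≟ y) (h ∘ fsuc))

_≟ⱽ_ : ∀ {k n} → (v w : Vec (Fin k) n) → Dec (v ≡ w)
_≟ⱽ_ = Vecₚ.≡-dec _≟_

∑-allVecs-suc : ∀ k n (g : Vec (Fin k) (suc n) → ℕ) →
                ∑ (allVecs k (suc n)) g ≡ ∑[ x ∈ allFin k ] ∑[ v ∈ allVecs k n ] g (x ∷ v)
∑-allVecs-suc k n g = trans (∑-concatMap (λ x → map (x ∷_) (allVecs k n)) (allFin k) g)
                            (∑-cong (allFin k) λ x → ∑-map (x ∷_) (allVecs k n) g)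

∑-allVecs-point : ∀ k n (y : Vec (Fin k) n) (d : ∀ v → Dec (v ≡ y)) (h : Vec (Fin k) n → ℕ) →
                  ∑[ v ∈ allVecs k n ] [ d v ]· h v ≡ h y
∑-allVecs-point k zero [] d h with d []
... | yes _ = ℕ.+-identityʳ _
... | no []≢[] = ⊥-elim ([]≢[] refl)
∑-allVecs-point k (suc n) (y ∷ ys) d h = begin
  ∑[ v ∈ allVecs k (suc n) ] [ d v ]· h v
    ≡⟨ ∑-allVecs-suc k n _ ⟩
  ∑[ x ∈ allFin k ] ∑[ v ∈ allVecs k n ] [ d (x ∷ v) ]· h (x ∷ v)
    ≡⟨ ∑-cong (allFin k) (λ x → ∑-cong (allVecs k n) λ v → sym (split x v)) ⟩
  ∑[ x ∈ allFin k ] ∑[ v ∈ allVecs k n ] [ x ≟ y ]· [ v ≟ⱽ ys ]· h (x ∷ v)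
    ≡⟨ ∑-cong (allFin k) (λ x → ∑-[]· (allVecs k n) (x ≟ y) _) ⟩
  ∑[ x ∈ allFin k ] [ x ≟ y ]· (∑[ v ∈ allVecs k n ] [ v ≟ⱽ ys ]· h (x ∷ v))
    ≡⟨ ∑-cong (allFin k) (λ x → cong ([ x ≟ y ]·_) (∑-allVecs-point k n ys (_≟ⱽ ys) (h ∘ (x ∷_)))) ⟩
  ∑[ x ∈ allFin k ] [ x ≟ y ]· h (x ∷ ys)
    ≡⟨ ∑-allFin-point y (_≟ y) (λ x → h (x ∷ ys)) ⟩
  h (y ∷ ys) ∎
  where
  open ≡-Reasoning
  split : ∀ x v → [ x ≟ y ]· [ v ≟ⱽ ys ]· h (x ∷ v) ≡ [ d (x ∷ v) ]· h (x ∷ v)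
  split x v = []·-× (x ≟ y) (v ≟ⱽ ys) (d (x ∷ v)) _ Vecₚ.∷-injective λ { (refl , refl) → refl }

∑-allVecs-bijection : ∀ k n (φ ψ : Vec (Fin k) n → Vec (Fin k) n) →
                      (∀ v → ψ (φ v) ≡ v) → (∀ v → φ (ψ v) ≡ v) →
                      (h : Vec (Fin k) n → ℕ) → ∑ (allVecs k n) (h ∘ φ) ≡ ∑ (allVecs k n) h
∑-allVecs-bijection k n φ ψ ψφ φψ h = begin
  ∑[ v ∈ allVecs k n ] h (φ v)
    ≡⟨ ∑-cong (allVecs k n) (λ v → sym (∑-allVecs-point k n (φ v) (_≟ⱽ φ v) h)) ⟩
  ∑[ v ∈ allVecs k n ] ∑[ w ∈ allVecs k n ] [ w ≟ⱽ φ v ]· h w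
    ≡⟨ ∑-swap (allVecs k n) (allVecs k n) _ ⟩
  ∑[ w ∈ allVecs k n ] ∑[ v ∈ allVecs k n ] [ w ≟ⱽ φ v ]· h w
    ≡⟨ ∑-cong (allVecs k n) (λ w → ∑-cong (allVecs k n) λ v → []·-⇔ (w ≟ⱽ φ v) (v ≟ⱽ ψ w) (h w)
         (λ { refl → sym (ψφ v) }) (λ { refl → sym (φψ w) })) ⟩
  ∑[ w ∈ allVecs k n ] ∑[ v ∈ allVecs k n ] [ v ≟ⱽ ψ w ]· h w
    ≡⟨ ∑-cong (allVecs k n) (λ w → ∑-allVecs-point k n (ψ w) (_≟ⱽ ψ w) (λ _ → h w)) ⟩
  ∑[ w ∈ allVecs k n ] h w ∎
  where open ≡-Reasoning

-- Sequences with prescribed weak and strict ascents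

-- next b x is the least value allowed to follow x: a bit b = 0 forces a strict ascent.
next : ℕ → ℕ → ℕ
next zero x = suc x
next (suc _) x = x

Rises : ∀ {m} → List ℕ → List (Fin m) → Set
Rises (b ∷ bs) (x ∷ y ∷ ys) = next b (toℕ x) ≤ toℕ y × Rises bs (y ∷ ys)
Rises _ _ = ⊤

Rises? : ∀ {m} bs (xs : List (Fin m)) → Dec (Rises bs xs)
Rises? [] _ = yes tt
Rises? (b ∷ bs) [] = yes tt
Rises? (b ∷ bs) (x ∷ []) = yes tt
Rises? (b ∷ bs) (x ∷ y ∷ ys) = (next b (toℕ x) ≤? toℕ y) ×-dec Rises? bs (y ∷ ys)

m∸n≡1+o⇒m∸[1+n]≡o : ∀ m n {o} → m ∸ n ≡ suc o → m ∸ suc n ≡ o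
m∸n≡1+o⇒m∸[1+n]≡o m n m∸n≡1+o = trans (sym (ℕ.pred[m∸n]≡m∸[1+n] m n)) (cong pred m∸n≡1+o)

∑-from : ℕ → ℕ → (ℕ → ℕ) → ℕ
∑-from m c H = ∑[ x ∈ allFin m ] [ c ≤? toℕ x ]· H (toℕ x)

∑-from-empty : ∀ m c H → m ≤ c → ∑-from m c H ≡ 0
∑-from-empty m c H m≤c = ∑-[]·-⊥ (allFin m) (λ x → c ≤? toℕ x) (H ∘ toℕ) λ x c≤x →
  ℕ.<-irrefl refl (ℕ.<-≤-trans (Fin.toℕ<n x) (ℕ.≤-trans m≤c c≤x))

∑-from-split : ∀ m c H → c <ℕ m → ∑-from m c H ≡ H c + ∑-from m (suc c) H
∑-from-split m c H c<m = begin
  ∑-from m c H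
    ≡⟨ ∑-cong (allFin m) (λ x → split (H (toℕ x)) (c ≤? toℕ x) (toℕ x ℕ.≟ c) (suc c ≤? toℕ x)) ⟩
  ∑[ x ∈ allFin m ] ([ toℕ x ℕ.≟ c ]· H (toℕ x) + [ suc c ≤? toℕ x ]· H (toℕ x))
    ≡⟨ ∑-+ (allFin m) _ _ ⟩
  (∑[ x ∈ allFin m ] [ toℕ x ℕ.≟ c ]· H (toℕ x)) + ∑-from m (suc c) H
    ≡⟨ cong (_+ ∑-from m (suc c) H) at-c ⟩
  H c + ∑-from m (suc c) H ∎
  where
  open ≡-Reasoning
  split : ∀ {x} k (p : Dec (c ≤ x)) (q : Dec (x ≡ c)) (r : Dec (suc c ≤ x)) → [ p ]· k ≡ [ q ]· k + [ r ]· k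
  split k (yes _) (yes refl) (yes c<c) = ⊥-elim (ℕ.<-irrefl refl c<c)
  split k (yes _) (yes _) (no _) = sym (ℕ.+-identityʳ k)
  split k (yes _) (no _) (yes _) = refl
  split k (yes c≤x) (no x≢c) (no c≮x) = ⊥-elim (c≮x (ℕ.≤∧≢⇒< c≤x (x≢c ∘ sym)))
  split k (no c≰c) (yes refl) _ = ⊥-elim (c≰c ℕ.≤-refl)
  split k (no c≰x) (no _) (yes c<x) = ⊥-elim (c≰x (ℕ.<⇒≤ c<x))
  split k (no _) (no _) (no _) = refl
  at-c : ∑[ x ∈ allFin m ] [ toℕ x ℕ.≟ c ]· H (toℕ x) ≡ H c
  at-c = begin
    ∑[ x ∈ allFin m ] [ toℕ x ℕ.≟ c ]· H (toℕ x)
      ≡⟨ ∑-cong (allFin m) (λ x → []·-⇔ (toℕ x ℕ.≟ c) (x ≟ fromℕ< c<m) _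
           (λ e → Fin.toℕ-injective (trans e (sym (Fin.toℕ-fromℕ< c<m))))
           (λ { refl → Fin.toℕ-fromℕ< c<m })) ⟩
    ∑[ x ∈ allFin m ] [ x ≟ fromℕ< c<m ]· H (toℕ x)
      ≡⟨ ∑-allFin-point (fromℕ< c<m) (_≟ fromℕ< c<m) (H ∘ toℕ) ⟩
    H (toℕ (fromℕ< c<m))
      ≡⟨ cong H (Fin.toℕ-fromℕ< c<m) ⟩
    H c ∎

∑-from-telescope : ∀ m H (G : ℕ → ℕ) → G 0 ≡ 0 →
                   (∀ c t → m ∸ c ≡ suc t → H c + G t ≡ G (suc t)) →
                   ∀ c → ∑-from m c H ≡ G (m ∸ c)
∑-from-telescope m H G G0 step c = go (m ∸ c) c refl
  where
  go : ∀ t c → m ∸ c ≡ t → ∑-from m c H ≡ G t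
  go zero c m∸c≡0 = trans (∑-from-empty m c H (ℕ.m∸n≡0⇒m≤n m∸c≡0)) (sym G0)
  go (suc t) c m∸c≡1+t = begin
    ∑-from m c H             ≡⟨ ∑-from-split m c H c<m ⟩
    H c + ∑-from m (suc c) H ≡⟨ cong (H c +_) (go t (suc c) (m∸n≡1+o⇒m∸[1+n]≡o m c m∸c≡1+t)) ⟩
    H c + G t                ≡⟨ step c t m∸c≡1+t ⟩
    G (suc t)                ∎
    where
    open ≡-Reasoning
    c<m : c <ℕ m
    c<m = ℕ.m∸n≢0⇒n<m λ m∸c≡0 → ℕ.0≢1+n (trans (sym m∸c≡0) m∸c≡1+t)

sum≤length : ∀ (bs : List ℕ) → All (_≤ 1) bs → sum bs ≤ length bs
sum≤length [] [] = z≤n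
sum≤length (b ∷ bs) (b≤1 ∷ bs≤1) = ℕ.+-mono-≤ b≤1 (sum≤length bs bs≤1)

count-Rises-from : ∀ m k (bs : List ℕ) → length bs ≡ k → All (_≤ 1) bs → ∀ c →
                   ∑[ v ∈ allVecs m (suc k) ] [ (c ≤? toℕ (head v)) ×-dec Rises? bs (toList v) ]· 1
                   ≡ (m ∸ c + sum bs) C suc k
count-Rises-from m zero [] refl [] c = begin
  ∑[ v ∈ allVecs m 1 ] [ (c ≤? toℕ (head v)) ×-dec yes tt ]· 1
    ≡⟨ ∑-allVecs-suc m 0 _ ⟩
  ∑[ x ∈ allFin m ] ([ (c ≤? toℕ x) ×-dec yes tt ]· 1 + 0)
    ≡⟨ ∑-cong (allFin m) (λ x → trans (ℕ.+-identityʳ _) ([]·-⇔ _ (c ≤? toℕ x) 1 proj₁ (_, tt))) ⟩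
  ∑-from m c (λ _ → 1)
    ≡⟨ ∑-from-telescope m (λ _ → 1) id refl (λ _ _ _ → refl) c ⟩
  m ∸ c
    ≡⟨ sym (trans (cong (_C 1) (ℕ.+-identityʳ (m ∸ c))) (nC1≡n (m ∸ c))) ⟩
  (m ∸ c + 0) C 1 ∎
  where open ≡-Reasoning
count-Rises-from m (suc k) (b ∷ bs) |bs| (b≤1 ∷ bs≤1) c = begin
  ∑[ v ∈ allVecs m (suc (suc k)) ] [ (c ≤? toℕ (head v)) ×-dec Rises? (b ∷ bs) (toList v) ]· 1
    ≡⟨ ∑-allVecs-suc m (suc k) _ ⟩
  ∑[ x ∈ allFin m ] ∑[ v ∈ allVecs m (suc k) ] [ (c ≤? toℕ x) ×-dec Rises? (b ∷ bs) (toList (x ∷ v)) ]· 1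
    ≡⟨ ∑-cong (allFin m) (λ x → ∑-cong (allVecs m (suc k)) (λ v → sym (peel x v))) ⟩
  ∑[ x ∈ allFin m ] ∑[ v ∈ allVecs m (suc k) ] [ c ≤? toℕ x ]· [ tail? x v ]· 1
    ≡⟨ ∑-cong (allFin m) (λ x → ∑-[]· (allVecs m (suc k)) (c ≤? toℕ x) _) ⟩
  ∑-from m c (λ x → ∑[ v ∈ allVecs m (suc k) ] [ (next b x ≤? toℕ (head v)) ×-dec Rises? bs (toList v) ]· 1)
    ≡⟨ ∑-cong (allFin m) (λ x → cong ([ c ≤? toℕ x ]·_)
         (count-Rises-from m k bs (cong pred |bs|) bs≤1 (next b (toℕ x)))) ⟩
  ∑-from m c H
    ≡⟨ ∑-from-telescope m H G G0 pascal c ⟩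
  G (m ∸ c) ∎
  where
  open ≡-Reasoning
  tail? : ∀ x (v : Vec (Fin m) (suc k)) → Dec (next b (toℕ x) ≤ toℕ (head v) × Rises bs (toList v))
  tail? x v = (next b (toℕ x) ≤? toℕ (head v)) ×-dec Rises? bs (toList v)
  peel : ∀ x v → [ c ≤? toℕ x ]· [ tail? x v ]· 1
                 ≡ [ (c ≤? toℕ x) ×-dec Rises? (b ∷ bs) (toList (x ∷ v)) ]· 1
  peel x (y ∷ v) = []·-× (c ≤? toℕ x) (tail? x (y ∷ v)) _ 1 id id
  H : ℕ → ℕ
  H x = (m ∸ next b x + sum bs) C suc k
  G : ℕ → ℕ
  G t = (t + (b + sum bs)) C suc (suc k)
  G0 : G 0 ≡ 0
  G0 = k>n⇒nCk≡0 (s≤s (subst (b + sum bs ≤_) |bs| (ℕ.+-mono-≤ b≤1 (sum≤length bs bs≤1))))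
  pascal : ∀ x t → m ∸ x ≡ suc t → H x + G t ≡ G (suc t)
  pascal x t m∸x≡1+t = trans (cong (λ z → (z C suc k) + G t) (window b b≤1))
                             (nCk+nC[k+1]≡[n+1]C[k+1] (t + (b + sum bs)) (suc k))
    where
    window : ∀ b → b ≤ 1 → m ∸ next b x + sum bs ≡ t + (b + sum bs)
    window zero _ = cong (_+ sum bs) (m∸n≡1+o⇒m∸[1+n]≡o m x m∸x≡1+t)
    window (suc zero) _ = trans (cong (_+ sum bs) m∸x≡1+t) (sym (ℕ.+-suc t (sum bs)))
    window (suc (suc _)) (s≤s ())

count-Rises : ∀ m n (bs : List ℕ) → length bs ≡ n ∸ 1 → All (_≤ 1) bs →
              ∑[ v ∈ allVecs m n ] [ Rises? bs (toList v) ]· 1 ≡ (m + sum bs) C n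
count-Rises m zero [] refl [] = refl
count-Rises m (suc k) bs |bs| bs≤1 =
  trans (∑-cong (allVecs m (suc k)) λ v →
           []·-⇔ _ ((0 ≤? toℕ (head v)) ×-dec Rises? bs (toList v)) 1 (z≤n ,_) proj₂)
        (count-Rises-from m k bs |bs| bs≤1 0)

<⇒next≤ : ∀ b {x y} → x <ℕ y → next b x ≤ y
<⇒next≤ zero x<y = x<y
<⇒next≤ (suc _) x<y = ℕ.<⇒≤ x<y

next-≤⇒≤ : ∀ b {x y} → next b x ≤ y → x ≤ y
next-≤⇒≤ zero x<y = ℕ.<⇒≤ x<y
next-≤⇒≤ (suc _) x≤y = x≤y

-- Vectors, sorted lists and insertion sort

lookup-ext : (v w : Vec A k) → (∀ i → lookup v i ≡ lookup w i) → v ≡ w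
lookup-ext v w v≗w =
  trans (sym (Vecₚ.tabulate∘lookup v)) (trans (Vecₚ.tabulate-cong v≗w) (Vecₚ.tabulate∘lookup w))

toList-tabulate : (f : Fin k → A) → toList (tabulate f) ≡ List.tabulate f
toList-tabulate {k = zero} f = refl
toList-tabulate {k = suc k} f = cong (f fzero ∷_) (toList-tabulate (λ i → f (fsuc i)))

∈-toList⇒lookup : (v : Vec A k) {z : A} → z ∈ toList v → ∃ λ i → lookup v i ≡ z
∈-toList⇒lookup v z∈v = let z∈ = ∈-toList⁻ z∈v in VecAny.index z∈ , sym (lookup-index z∈)

injective⇒surjective : (f : Fin k → Fin k) → (∀ {i j} → f i ≡ f j → i ≡ j) → ∀ y → ∃ λ i → f i ≡ y
injective⇒surjective {k = suc k} f inj y with Fin.any? (λ i → f i Fin.≟ y)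
... | yes hit = hit
... | no miss with Fin.pigeonhole (ℕ.n<1+n k) (λ i → punchOut {i = y} {j = f i} (λ e → miss (i , sym e)))
... | i , j , i<j , e = ⊥-elim (Fin.<-irrefl (inj (Fin.punchOut-injective {i = y}
                                  (λ e′ → miss (i , sym e′)) (λ e′ → miss (j , sym e′)) e)) i<j)

module _ {R : Rel A 0ℓ} where

  AllPairs-lookup : (v : Vec A k) → AllPairs R (toList v) → ∀ {i j} → i < j → R (lookup v i) (lookup v j)
  AllPairs-lookup (x ∷ v) (Rx ∷ _) {fzero} {fsuc j} _ = All.lookup Rx (∈-toList⁺ (∈-lookup j v))
  AllPairs-lookup (x ∷ v) (_ ∷ Rv) {fsuc i} {fsuc j} (s≤s i<j) = AllPairs-lookup v Rv i<j

  AllPairs-lookup-injective : (v : Vec A k) → (∀ {x} → ¬ R x x) → AllPairs R (toList v) →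
                              ∀ {i j} → lookup v i ≡ lookup v j → i ≡ j
  AllPairs-lookup-injective v irrefl Rv {i} {j} vᵢ≡vⱼ with Fin.<-cmp i j
  ... | tri< i<j _ _ = ⊥-elim (irrefl (subst (R _) (sym vᵢ≡vⱼ) (AllPairs-lookup v Rv i<j)))
  ... | tri≈ _ i≡j _ = i≡j
  ... | tri> _ _ j<i = ⊥-elim (irrefl (subst (R _) vᵢ≡vⱼ (AllPairs-lookup v Rv j<i)))

  lookup-forward⇒AllPairs : (v : Vec A k) → (∀ i j → R (lookup v i) (lookup v j) → i < j) →
                            AllPairs (λ x y → ¬ R y x) (toList v)
  lookup-forward⇒AllPairs [] _ = []
  lookup-forward⇒AllPairs (x ∷ v) fwd =
    All.tabulate backwards ∷ lookup-forward⇒AllPairs v (λ i j r → ℕ.≤-pred (fwd (fsuc i) (fsuc j) r))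
    where
    backwards : ∀ {y} → y ∈ toList v → ¬ R y x
    backwards y∈v r with ∈-toList⇒lookup v y∈v
    ... | i , refl with fwd (fsuc i) fzero r
    ... | ()

module StrictTotalOrder
  {A : Set} (_<_ : Rel A 0ℓ) (<-trans : Transitive _<_) (<-irrefl : ∀ {x} → ¬ x < x)
  (<-total : ∀ {x y} → x ≢ y → x < y ⊎ y < x) (_<?_ : Decidable _<_) where

  <-asym : ∀ {x y} → x < y → ¬ y < x
  <-asym x<y y<x = <-irrefl (<-trans x<y y<x)

  insert : A → Vec A k → Vec A (suc k)
  insert x [] = x ∷ []
  insert x (y ∷ ys) with x <? y
  ... | yes _ = x ∷ y ∷ ys
  ... | no _ = y ∷ insert x ys

  ∈-insert⁻ : ∀ x (ys : Vec A k) {z} → z ∈ toList (insert x ys) → z ≡ x ⊎ z ∈ toList ys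
  ∈-insert⁻ x [] (here z≡x) = inj₁ z≡x
  ∈-insert⁻ x (y ∷ ys) z∈ with x <? y | z∈
  ... | yes _ | here z≡x = inj₁ z≡x
  ... | yes _ | there z∈ys = inj₂ z∈ys
  ... | no _ | here z≡y = inj₂ (here z≡y)
  ... | no _ | there z∈ with ∈-insert⁻ x ys z∈
  ...   | inj₁ z≡x = inj₁ z≡x
  ...   | inj₂ z∈ys = inj₂ (there z∈ys)

  ∈-insert⁺ : ∀ x (ys : Vec A k) {z} → z ≡ x ⊎ z ∈ toList ys → z ∈ toList (insert x ys)
  ∈-insert⁺ x [] (inj₁ z≡x) = here z≡x
  ∈-insert⁺ x (y ∷ ys) z∈ with x <? y | z∈
  ... | yes _ | inj₁ z≡x = here z≡x
  ... | yes _ | inj₂ z∈ys = there z∈ys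
  ... | no _ | inj₁ z≡x = there (∈-insert⁺ x ys (inj₁ z≡x))
  ... | no _ | inj₂ (here z≡y) = here z≡y
  ... | no _ | inj₂ (there z∈ys) = there (∈-insert⁺ x ys (inj₂ z∈ys))

  insert-sorted : ∀ x (ys : Vec A k) → AllPairs _<_ (toList ys) → x ∉ toList ys →
                  AllPairs _<_ (toList (insert x ys))
  insert-sorted x [] _ _ = [] ∷ []
  insert-sorted x (y ∷ ys) sorted x∉ with x <? y
  insert-sorted x (y ∷ ys) sorted@(y<ys ∷ _) x∉ | yes x<y = (x<y ∷ All.map (<-trans x<y) y<ys) ∷ sorted
  insert-sorted x (y ∷ ys) (y<ys ∷ ys-sorted) x∉ | no x≮y =
    All.tabulate y<insert ∷ insert-sorted x ys ys-sorted (λ x∈ → x∉ (there x∈))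
    where
    y<insert : ∀ {z} → z ∈ toList (insert x ys) → y < z
    y<insert z∈ with ∈-insert⁻ x ys z∈ | <-total {x} {y} (λ x≡y → x∉ (here x≡y))
    ... | inj₁ refl | inj₁ x<y = ⊥-elim (x≮y x<y)
    ... | inj₁ refl | inj₂ y<x = y<x
    ... | inj₂ z∈ys | _ = All.lookup y<ys z∈ys

  sort : Vec A k → Vec A k
  sort [] = []
  sort (x ∷ v) = insert x (sort v)

  ∈-sort⁻ : (v : Vec A k) {z : A} → z ∈ toList (sort v) → z ∈ toList v
  ∈-sort⁻ (x ∷ v) z∈ with ∈-insert⁻ x (sort v) z∈
  ... | inj₁ z≡x = here z≡x
  ... | inj₂ z∈sort = there (∈-sort⁻ v z∈sort)

  ∈-sort⁺ : (v : Vec A k) {z : A} → z ∈ toList v → z ∈ toList (sort v)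
  ∈-sort⁺ (x ∷ v) (here z≡x) = ∈-insert⁺ x (sort v) (inj₁ z≡x)
  ∈-sort⁺ (x ∷ v) (there z∈v) = ∈-insert⁺ x (sort v) (inj₂ (∈-sort⁺ v z∈v))

  sort-sorted : (v : Vec A k) → AllPairs _≢_ (toList v) → AllPairs _<_ (toList (sort v))
  sort-sorted [] _ = []
  sort-sorted (x ∷ v) (x∉v ∷ distinct) =
    insert-sorted x (sort v) (sort-sorted v distinct) (λ x∈ → All.lookup x∉v (∈-sort⁻ v x∈) refl)

  drop-head-⊆ : ∀ {x xs ys} → All (x <_) xs → (∀ {z} → z ∈ x ∷ xs → z ∈ x ∷ ys) →
                ∀ {z} → z ∈ xs → z ∈ ys
  drop-head-⊆ x<xs ⊆ z∈xs with ⊆ (there z∈xs)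
  ... | here refl = ⊥-elim (<-irrefl (All.lookup x<xs z∈xs))
  ... | there z∈ys = z∈ys

  sorted-unique : ∀ {xs ys : List A} → AllPairs _<_ xs → AllPairs _<_ ys →
                  (∀ {z} → z ∈ xs → z ∈ ys) → (∀ {z} → z ∈ ys → z ∈ xs) → xs ≡ ys
  sorted-unique {[]} {[]} _ _ _ _ = refl
  sorted-unique {[]} {y ∷ ys} _ _ _ ys⊆xs with ys⊆xs (here refl)
  ... | ()
  sorted-unique {x ∷ xs} {[]} _ _ xs⊆ys _ with xs⊆ys (here refl)
  ... | ()
  sorted-unique {x ∷ xs} {y ∷ ys} (x<xs ∷ sxs) (y<ys ∷ sys) xs⊆ys ys⊆xs
    with xs⊆ys (here refl) | ys⊆xs (here refl)
  ... | there x∈ys | there y∈xs = ⊥-elim (<-asym (All.lookup y<ys x∈ys) (All.lookup x<xs y∈xs))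
  ... | here refl | _ =
    cong (x ∷_) (sorted-unique sxs sys (drop-head-⊆ x<xs xs⊆ys) (drop-head-⊆ y<ys ys⊆xs))
  ... | there _ | here refl =
    cong (x ∷_) (sorted-unique sxs sys (drop-head-⊆ x<xs xs⊆ys) (drop-head-⊆ y<ys ys⊆xs))

-- Reachability and its linear extension

module Reachability {n : ℕ} (D : Digraph n) where

  Arc? : Decidable (Arc D)
  Arc? u v = D u v Bool.≟ true

  Reach : ℕ → Fin n → Fin n → Set
  Reach zero u v = Arc D u v
  Reach (suc k) u v = Arc D u v ⊎ ∃ λ w → Arc D u w × Reach k w v

  Reach? : ∀ k → Decidable (Reach k)
  Reach? zero u v = Arc? u v
  Reach? (suc k) u v = Arc? u v ⊎-dec Fin.any? (λ w → Arc? u w ×-dec Reach? k w v)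

  Reach⇒Prec : ∀ k {u v} → Reach k u v → Prec D u v
  Reach⇒Prec zero uv = [ uv ]
  Reach⇒Prec (suc k) (inj₁ uv) = [ uv ]
  Reach⇒Prec (suc k) (inj₂ (w , uw , wv)) = uw ∷ Reach⇒Prec k wv

  Reach-mono : ∀ {k l u v} → k ≤ l → Reach k u v → Reach l u v
  Reach-mono {zero} {zero} _ uv = uv
  Reach-mono {zero} {suc l} _ uv = inj₁ uv
  Reach-mono {suc k} {suc l} _ (inj₁ uv) = inj₁ uv
  Reach-mono {suc k} {suc l} (s≤s k≤l) (inj₂ (w , uw , wv)) = inj₂ (w , uw , Reach-mono k≤l wv)

  intermediates : ∀ {u v} → Prec D u v → ℕ
  intermediates [ _ ] = 0
  intermediates (_ ∷ p) = suc (intermediates p)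

  Prec⇒Reach : ∀ {u v} (p : Prec D u v) → Reach (intermediates p) u v
  Prec⇒Reach [ uv ] = uv
  Prec⇒Reach (uw ∷ p) = inj₂ (_ , uw , Prec⇒Reach p)

  tails : ∀ {u v} (p : Prec D u v) → Vec (Fin n) (suc (intermediates p))
  tails {u} [ _ ] = u ∷ []
  tails {u} (_ ∷ p) = u ∷ tails p

  Star-tails : ∀ {u v} (p : Prec D u v) j → Star (Arc D) u (lookup (tails p) j)
  Star-tails [ _ ] fzero = ε
  Star-tails (_ ∷ p) fzero = ε
  Star-tails (uw ∷ p) (fsuc j) = uw ◅ Star-tails p j

  Prec-tails : ∀ {u v} (p : Prec D u v) {i j} → i < j → Prec D (lookup (tails p) i) (lookup (tails p) j)
  Prec-tails (uw ∷ p) {fzero} {fsuc j} _ = arc◅ uw (Star-tails p j)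
    where
    arc◅ : ∀ {u w x} → Arc D u w → Star (Arc D) w x → Prec D u x
    arc◅ uw ε = [ uw ]
    arc◅ uw (wy ◅ yx) = uw ∷ arc◅ wy yx
  Prec-tails (_ ∷ p) {fsuc i} {fsuc j} (s≤s i<j) = Prec-tails p i<j

  module Decidability (acyclic : Acyclic D) where

    -- The vertices a path leaves are pairwise distinct, so there are at most n of them.
    intermediates<n : ∀ {u v} (p : Prec D u v) → intermediates p <ℕ n
    intermediates<n p with suc (intermediates p) ℕ.≤? n
    ... | yes fits = fits
    ... | no too-long with Fin.pigeonhole (ℕ.≰⇒> too-long) (lookup (tails p))
    ... | i , j , i<j , tᵢ≡tⱼ = ⊥-elim (acyclic _ (subst (Prec D _) (sym tᵢ≡tⱼ) (Prec-tails p i<j)))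

    Prec? : Decidable (Prec D)
    Prec? u v = map′ (Reach⇒Prec n) (λ p → Reach-mono (ℕ.<⇒≤ (intermediates<n p)) (Prec⇒Reach p))
                     (Reach? n u v)

  Prec-forward : ∀ π → IsOP D π → ∀ {u v} → Prec D u v →
                 ∀ i j → lookup π i ≡ u → lookup π j ≡ v → i < j
  Prec-forward π (_ , arcs-forward) [ uv ] i j refl refl = arcs-forward i j uv
  Prec-forward π op@(distinct , arcs-forward) (_∷_ {y = w} uw wv) i j refl refl
    with injective⇒surjective (lookup π) (distinct _ _) w
  ... | k , refl = Fin.<-trans (arcs-forward i k uw) (Prec-forward π op wv k j refl refl)

module LinearExtension {n : ℕ} (D : Digraph n) (acyclic : Acyclic D) (wempty : WEmpty D) where

  open Reachability D
  open Decidability acyclic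

  -- The only use of W(D) = ∅: for a single arc p → q a counterexample b would make {q, b, p}
  -- a member of W(D); a longer path is cut at its second vertex.
  between-comparable : ∀ {p q} → Prec D p q → ∀ b → q < b → b < p → ¬ Prec D p b → ¬ Prec D b q → ⊥
  between-comparable [ pq ] b q<b b<p ¬pb ¬bq =
    wempty _ b _ (q<b , b<p , pq , ((λ qb → ¬pb (pq ∷ qb)) , ¬bq) , (¬pb , λ bp → ¬bq (bp ∷ʳ pq)))
  between-comparable (_∷_ {y = x} px xq) b q<b b<p ¬pb ¬bq with Fin.<-cmp x b
  ... | tri< x<b _ _ = between-comparable [ px ] b x<b b<p ¬pb (λ bx → ¬bq (bx ++ xq))
  ... | tri≈ _ refl _ = ¬pb [ px ]
  ... | tri> _ _ b<x = between-comparable xq b q<b b<x (λ xb → ¬pb (px ∷ xb)) ¬bq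

  _⊲_ : Fin n → Fin n → Set
  u ⊲ v = Prec D u v ⊎ (Incomp D u v × u < v)

  ⊲-irrefl : ∀ {u} → ¬ u ⊲ u
  ⊲-irrefl (inj₁ uu) = acyclic _ uu
  ⊲-irrefl (inj₂ (_ , u<u)) = Fin.<-irrefl refl u<u

  _⊲?_ : Decidable _⊲_
  u ⊲? v = Prec? u v ⊎-dec ((¬? (Prec? u v) ×-dec ¬? (Prec? v u)) ×-dec (u Fin.<? v))

  ⊲-total : ∀ {u v} → u ≢ v → u ⊲ v ⊎ v ⊲ u
  ⊲-total {u} {v} u≢v with Prec? u v | Prec? v u | Fin.<-cmp u v
  ... | yes uv | _ | _ = inj₁ (inj₁ uv)
  ... | no _ | yes vu | _ = inj₂ (inj₁ vu)
  ... | no ¬uv | no ¬vu | tri< u<v _ _ = inj₁ (inj₂ ((¬uv , ¬vu) , u<v))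
  ... | no _ | no _ | tri≈ _ u≡v _ = ⊥-elim (u≢v u≡v)
  ... | no ¬uv | no ¬vu | tri> _ _ v<u = inj₂ (inj₂ ((¬vu , ¬uv) , v<u))

  ⊲-trans : ∀ {u v w} → u ⊲ v → v ⊲ w → u ⊲ w
  ⊲-trans {u} {v} {w} u⊲v v⊲w with Prec? u w
  ... | yes uw = inj₁ uw
  ... | no ¬uw = inj₂ ((¬uw , ¬wu u⊲v v⊲w) , <-from u⊲v v⊲w)
    where
    ¬wu : u ⊲ v → v ⊲ w → ¬ Prec D w u
    ¬wu (inj₁ uv) (inj₁ vw) wu = acyclic _ (uv ++ vw ++ wu)
    ¬wu (inj₁ uv) (inj₂ ((_ , ¬wv) , _)) wu = ¬wv (wu ++ uv)
    ¬wu (inj₂ ((_ , ¬vu) , _)) (inj₁ vw) wu = ¬vu (vw ++ wu)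
    ¬wu (inj₂ ((_ , ¬vu) , u<v)) (inj₂ ((_ , ¬wv) , v<w)) wu =
      between-comparable wu v u<v v<w ¬wv ¬vu
    <-unless : u ≢ w → ¬ w < u → u < w
    <-unless u≢w w≮u with Fin.<-cmp u w
    ... | tri< u<w _ _ = u<w
    ... | tri≈ _ u≡w _ = ⊥-elim (u≢w u≡w)
    ... | tri> _ _ w<u = ⊥-elim (w≮u w<u)
    <-from : u ⊲ v → v ⊲ w → u < w
    <-from (inj₁ uv) (inj₁ vw) = ⊥-elim (¬uw (uv ++ vw))
    <-from (inj₁ uv) (inj₂ ((_ , ¬wv) , v<w)) =
      <-unless (λ { refl → ¬wv uv }) λ w<u → between-comparable uv w v<w w<u ¬uw ¬wv
    <-from (inj₂ ((_ , ¬vu) , u<v)) (inj₁ vw) =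
      <-unless (λ { refl → ¬vu vw }) λ w<u → between-comparable vw u w<u u<v ¬vu ¬uw
    <-from (inj₂ (_ , u<v)) (inj₂ (_ , v<w)) = Fin.<-trans u<v v<w

-- Orderings compatible with a map to [m]

module _ {n : ℕ} (D : Digraph n) where

  δs : List (Fin n) → List ℕ
  δs (a ∷ b ∷ rest) = δ D a b ∷ δs (b ∷ rest)
  δs _ = []

  δList≡sum-δs : ∀ xs → δList D xs ≡ sum (δs xs)
  δList≡sum-δs [] = refl
  δList≡sum-δs (a ∷ []) = refl
  δList≡sum-δs (a ∷ b ∷ rest) = cong (δ D a b +_) (δList≡sum-δs (b ∷ rest))

  length-δs : ∀ {k} (v : Vec (Fin n) k) → length (δs (toList v)) ≡ k ∸ 1
  length-δs [] = refl
  length-δs (a ∷ []) = refl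
  length-δs (a ∷ b ∷ v) = cong suc (length-δs (b ∷ v))

  δ≤1 : ∀ a b → δ D a b ≤ 1
  δ≤1 a b with (toℕ a <ᵇ toℕ b) ∨ D a b
  ... | true = s≤s z≤n
  ... | false = z≤n

  δs≤1 : ∀ xs → All (_≤ 1) (δs xs)
  δs≤1 [] = []
  δs≤1 (a ∷ []) = []
  δs≤1 (a ∷ b ∷ rest) = δ≤1 a b ∷ δs≤1 (b ∷ rest)

  δ-< : ∀ {a b} → a < b → δ D a b ≡ 1
  δ-< {a} {b} a<b rewrite Equivalence.to Bool.T-≡ (ℕ.<⇒<ᵇ a<b) = refl

  δ-arc : ∀ {a b} → Arc D a b → δ D a b ≡ 1
  δ-arc {a} {b} ab rewrite ab | Bool.∨-zeroʳ (toℕ a <ᵇ toℕ b) = refl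

  δ≢0 : ∀ {a b} → δ D a b ≢ 0 → a < b ⊎ Arc D a b
  δ≢0 {a} {b} δ≢0 with toℕ a <ᵇ toℕ b in a<ᵇb | D a b
  ... | true | _ = inj₁ (ℕ.<ᵇ⇒< (toℕ a) (toℕ b) (Equivalence.from Bool.T-≡ a<ᵇb))
  ... | false | true = inj₂ refl
  ... | false | false = ⊥-elim (δ≢0 refl)

module Refinement {n : ℕ} (D : Digraph n) (acyclic : Acyclic D) (wempty : WEmpty D)
                  {m : ℕ} (σ : Vec (Fin m) n) where

  open Reachability D
  open Decidability acyclic
  open LinearExtension D acyclic wempty

  s : Fin n → ℕ
  s u = toℕ (lookup σ u)

  _⊏_ : Fin n → Fin n → Set
  u ⊏ v = s u <ℕ s v ⊎ (s u ≡ s v × u ⊲ v)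

  ⊏-trans : ∀ {u v w} → u ⊏ v → v ⊏ w → u ⊏ w
  ⊏-trans (inj₁ su<sv) (inj₁ sv<sw) = inj₁ (ℕ.<-trans su<sv sv<sw)
  ⊏-trans {u} (inj₁ su<sv) (inj₂ (sv≡sw , _)) = inj₁ (subst (s u <ℕ_) sv≡sw su<sv)
  ⊏-trans {w = w} (inj₂ (su≡sv , _)) (inj₁ sv<sw) = inj₁ (subst (_<ℕ s w) (sym su≡sv) sv<sw)
  ⊏-trans (inj₂ (su≡sv , u⊲v)) (inj₂ (sv≡sw , v⊲w)) = inj₂ (trans su≡sv sv≡sw , ⊲-trans u⊲v v⊲w)

  ⊏-irrefl : ∀ {u} → ¬ u ⊏ u
  ⊏-irrefl (inj₁ su<su) = ℕ.<-irrefl refl su<su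
  ⊏-irrefl (inj₂ (_ , u⊲u)) = ⊲-irrefl u⊲u

  ⊏-total : ∀ {u v} → u ≢ v → u ⊏ v ⊎ v ⊏ u
  ⊏-total {u} {v} u≢v with ℕ.<-cmp (s u) (s v) | ⊲-total u≢v
  ... | tri< su<sv _ _ | _ = inj₁ (inj₁ su<sv)
  ... | tri> _ _ sv<su | _ = inj₂ (inj₁ sv<su)
  ... | tri≈ _ su≡sv _ | inj₁ u⊲v = inj₁ (inj₂ (su≡sv , u⊲v))
  ... | tri≈ _ su≡sv _ | inj₂ v⊲u = inj₂ (inj₂ (sym su≡sv , v⊲u))

  _⊏?_ : Decidable _⊏_
  u ⊏? v = (s u ℕ.<? s v) ⊎-dec ((s u ℕ.≟ s v) ×-dec (u ⊲? v))

  open StrictTotalOrder _⊏_ ⊏-trans ⊏-irrefl ⊏-total _⊏?_ public using (<-asym; sort; sorted-unique)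
  open StrictTotalOrder _⊏_ ⊏-trans ⊏-irrefl ⊏-total _⊏?_ using (sort-sorted; ∈-sort⁺)

  π₀ : Vec (Fin n) n
  π₀ = sort (Vec.allFin n)

  π₀-sorted : AllPairs _⊏_ (toList π₀)
  π₀-sorted = sort-sorted (Vec.allFin n) (subst (AllPairs _≢_) (sym (toList-tabulate id)) (Unique.allFin⁺ n))

  ∈-π₀ : ∀ u → u ∈ toList π₀
  ∈-π₀ u = ∈-sort⁺ (Vec.allFin n) (subst (u ∈_) (sym (toList-tabulate id)) (Membership.∈-allFin u))

  Compatible : List (Fin n) → Set
  Compatible xs = Rises (δs D xs) (List.map (lookup σ) xs)

  ArcMonotone : Set
  ArcMonotone = ∀ u v → Arc D u v → s u ≤ s v

  Prec-monotone : ArcMonotone → ∀ {u v} → Prec D u v → s u ≤ s v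
  Prec-monotone mono [ uv ] = mono _ _ uv
  Prec-monotone mono (uw ∷ wv) = ℕ.≤-trans (mono _ _ uw) (Prec-monotone mono wv)

  -- For ⊏-consecutive a, b of equal value, a ⊲ b cannot come from a path through some w, for
  -- monotonicity would give w the same value and put it between a and b; so δ(a,b) = 1.
  consecutive-rise : ArcMonotone → ∀ {a b} → a ⊏ b → (∀ w → a ⊏ w → w ⊏ b → ⊥) →
                     next (δ D a b) (s a) ≤ s b
  consecutive-rise mono (inj₁ sa<sb) _ = <⇒next≤ _ sa<sb
  consecutive-rise mono {a} {b} (inj₂ (sa≡sb , a⊲b)) nothing-between =
    subst (λ d → next d (s a) ≤ s b) (sym (δ≡1 a⊲b)) (ℕ.≤-reflexive sa≡sb)
    where
    δ≡1 : a ⊲ b → δ D a b ≡ 1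
    δ≡1 (inj₂ (_ , a<b)) = δ-< D a<b
    δ≡1 (inj₁ [ ab ]) = δ-arc D ab
    δ≡1 (inj₁ (_∷_ {y = w} aw wb)) =
      ⊥-elim (nothing-between w (inj₂ (sa≡sw , inj₁ [ aw ])) (inj₂ (sw≡sb , inj₁ wb)))
      where
      sa≤sw = mono _ _ aw
      sw≤sb = Prec-monotone mono wb
      sa≡sw : s a ≡ s w
      sa≡sw = ℕ.≤-antisym sa≤sw (subst (s w ≤_) (sym sa≡sb) sw≤sb)
      sw≡sb : s w ≡ s b
      sw≡sb = ℕ.≤-antisym sw≤sb (subst (_≤ s w) sa≡sb sa≤sw)

  FinalSegment : List (Fin n) → Set
  FinalSegment xs = ∀ w → w ∈ xs ⊎ All (w ⊏_) xs

  sorted⇒compatible : ArcMonotone → ∀ xs → AllPairs _⊏_ xs → FinalSegment xs → Compatible xs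
  sorted⇒compatible mono [] _ _ = tt
  sorted⇒compatible mono (a ∷ []) _ _ = tt
  sorted⇒compatible mono (a ∷ b ∷ rest) (a⊏ ∷ b⊏ ∷ sorted) final =
    consecutive-rise mono (All.lookup a⊏ (here refl)) nothing-between ,
    sorted⇒compatible mono (b ∷ rest) (b⊏ ∷ sorted) final′
    where
    nothing-between : ∀ w → a ⊏ w → w ⊏ b → ⊥
    nothing-between w a⊏w w⊏b with final w
    ... | inj₁ (here refl) = ⊏-irrefl a⊏w
    ... | inj₁ (there (here refl)) = ⊏-irrefl w⊏b
    ... | inj₁ (there (there w∈rest)) = <-asym (All.lookup b⊏ w∈rest) w⊏b
    ... | inj₂ (w⊏a ∷ _) = <-asym w⊏a a⊏w
    final′ : FinalSegment (b ∷ rest)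
    final′ w with final w
    ... | inj₁ (here refl) = inj₂ a⊏
    ... | inj₁ (there w∈) = inj₁ w∈
    ... | inj₂ (_ ∷ w⊏) = inj₂ w⊏

  rise⇒⊏ : ∀ {a b} → next (δ D a b) (s a) ≤ s b → ¬ Prec D b a → a ⊏ b
  rise⇒⊏ {a} {b} rise ¬ba with ℕ.m≤n⇒m<n∨m≡n (next-≤⇒≤ (δ D a b) rise)
  ... | inj₁ sa<sb = inj₁ sa<sb
  ... | inj₂ sa≡sb
    with δ≢0 D (λ δ≡0 → ℕ.<-irrefl sa≡sb (subst (λ d → next d (s a) ≤ s b) δ≡0 rise)) | Prec? a b
  ... | _ | yes ab = inj₂ (sa≡sb , inj₁ ab)
  ... | inj₂ ab | no _ = inj₂ (sa≡sb , inj₁ [ ab ])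
  ... | inj₁ a<b | no ¬ab = inj₂ (sa≡sb , inj₂ ((¬ab , ¬ba) , a<b))

  compatible⇒sorted : ∀ xs → Compatible xs → AllPairs (λ x y → ¬ Prec D y x) xs → AllPairs _⊏_ xs
  compatible⇒sorted xs compatible forward = Linked⇒AllPairs ⊏-trans (linked xs compatible forward)
    where
    linked : ∀ xs → Compatible xs → AllPairs (λ x y → ¬ Prec D y x) xs → Linked _⊏_ xs
    linked [] _ _ = []
    linked (a ∷ []) _ _ = [-]
    linked (a ∷ b ∷ rest) (rise , compatible) (¬ba ∷ forward) =
      rise⇒⊏ rise (All.lookup ¬ba (here refl)) ∷ linked (b ∷ rest) compatible forward

  Arc⇒⊏ : ArcMonotone → ∀ {u v} → Arc D u v → u ⊏ v
  Arc⇒⊏ mono {u} {v} uv with ℕ.m≤n⇒m<n∨m≡n (mono u v uv)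
  ... | inj₁ su<sv = inj₁ su<sv
  ... | inj₂ su≡sv = inj₂ (su≡sv , inj₁ [ uv ])

  π₀-isOP : ArcMonotone → IsOP D π₀
  π₀-isOP mono = (λ i j → AllPairs-lookup-injective π₀ ⊏-irrefl π₀-sorted) , arcs-forward
    where
    arcs-forward : ∀ i j → Arc D (lookup π₀ i) (lookup π₀ j) → i < j
    arcs-forward i j uv with Fin.<-cmp i j
    ... | tri< i<j _ _ = i<j
    ... | tri≈ _ refl _ = ⊥-elim (⊏-irrefl (Arc⇒⊏ mono uv))
    ... | tri> _ _ j<i = ⊥-elim (<-asym (Arc⇒⊏ mono uv) (AllPairs-lookup π₀ π₀-sorted j<i))

  π₀-compatible : ArcMonotone → Compatible (toList π₀)
  π₀-compatible mono = sorted⇒compatible mono (toList π₀) π₀-sorted (λ w → inj₁ (∈-π₀ w))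

  module _ {π : Vec (Fin n) n} (op : IsOP D π) (compatible : Compatible (toList π)) where

    private
      π-sorted : AllPairs _⊏_ (toList π)
      π-sorted = compatible⇒sorted (toList π) compatible
        (lookup-forward⇒AllPairs π λ i j vu → Prec-forward π op vu i j refl refl)

      position : ∀ u → ∃ λ i → lookup π i ≡ u
      position = injective⇒surjective (lookup π) (proj₁ op _ _)

    compatible⇒≡π₀ : π ≡ π₀
    compatible⇒≡π₀ = trans (sym (Vecₚ.cast-is-id refl π))
      (Vecₚ.toList-injective refl π π₀ (sorted-unique π-sorted π₀-sorted (λ {u} _ → ∈-π₀ u) ∈-π))
      where
      ∈-π : ∀ {u} → u ∈ toList π₀ → u ∈ toList π
      ∈-π {u} _ with position u
      ... | i , refl = ∈-toList⁺ (∈-lookup i π)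

    compatible⇒monotone : ArcMonotone
    compatible⇒monotone u v uv with position u | position v
    ... | i , refl | j , refl = ⊏⇒≤ (AllPairs-lookup π π-sorted (proj₂ op i j uv))
      where
      ⊏⇒≤ : ∀ {u v} → u ⊏ v → s u ≤ s v
      ⊏⇒≤ (inj₁ su<sv) = ℕ.<⇒≤ su<sv
      ⊏⇒≤ (inj₂ (su≡sv , _)) = ℕ.≤-reflexive su≡sv

  monotone⇒OrderPreserving : ArcMonotone → OrderPreserving D σ
  monotone⇒OrderPreserving mono u v ε = ℕ.≤-refl
  monotone⇒OrderPreserving mono u v (uw ◅ wv) = ℕ.≤-trans (mono _ _ uw) (monotone⇒OrderPreserving mono _ v wv)

  OrderPreserving⇒monotone : OrderPreserving D σ → ArcMonotone
  OrderPreserving⇒monotone preserving u v uv = preserving u v (uv ◅ ε)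

module Counting {n : ℕ} (D : Digraph n) (acyclic : Acyclic D) (wempty : WEmpty D) {m : ℕ} where

  open Reachability D using (Arc?)

  IsOP? : (π : Vec (Fin n) n) → Dec (IsOP D π)
  IsOP? π = Fin.all? (λ i → Fin.all? λ j → (lookup π i Fin.≟ lookup π j) →-dec (i Fin.≟ j))
      ×-dec Fin.all? (λ i → Fin.all? λ j → Arc? (lookup π i) (lookup π j) →-dec (i Fin.<? j))

  module _ (σ : Vec (Fin m) n) where
    open Refinement D acyclic wempty σ

    OrderPreserving? : Dec (OrderPreserving D σ)
    OrderPreserving? = map′ (monotone⇒OrderPreserving) OrderPreserving⇒monotone
      (Fin.all? λ u → Fin.all? λ v → Arc? u v →-dec (s u ℕ.≤? s v))

    Compatible? : (π : Vec (Fin n) n) → Dec (Compatible (toList π))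
    Compatible? π = Rises? _ _

    -- An order-preserving σ is compatible with exactly one ordering in OP(D), namely π₀.
    OrderPreserving-as-∑ :
      [ OrderPreserving? ]· 1 ≡ ∑[ π ∈ allVecs n n ] [ IsOP? π ]· [ Compatible? π ]· 1
    OrderPreserving-as-∑ with OrderPreserving?
    ... | yes preserving = sym (trans
          (∑-cong (allVecs n n) λ π → []·-× (IsOP? π) (Compatible? π) (π ≟ⱽ π₀) 1
             (λ { refl → π₀-isOP mono , π₀-compatible mono })
             (λ (op , compatible) → compatible⇒≡π₀ op compatible))
          (∑-allVecs-point n n π₀ (_≟ⱽ π₀) (λ _ → 1)))
      where mono = OrderPreserving⇒monotone preserving
    ... | no ¬preserving = sym (∑-zero (allVecs n n) λ π →
          []·-× (IsOP? π) (Compatible? π) (no λ ()) 1 (λ ())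
            λ (op , compatible) → ¬preserving (monotone⇒OrderPreserving (compatible⇒monotone op compatible)))

  -- Precomposition with an ordering π is a bijection on value vectors, turning compatibility
  -- with π into the rise pattern of the δ-bits of π.
  compatible-count : ∀ π → ∑[ σ ∈ allVecs m n ] [ IsOP? π ]· [ Compatible? σ π ]· 1
                           ≡ [ IsOP? π ]· ((m + δVec D π) C n)
  compatible-count π with IsOP? π
  ... | no _ = ∑-zero (allVecs m n) λ _ → refl
  ... | yes (distinct , _) = begin
    ∑[ σ ∈ allVecs m n ] [ Compatible? σ π ]· 1
      ≡⟨ ∑-cong (allVecs m n) (λ σ → []·-⇔ (Compatible? σ π) (Rises? bits (toList (σ∘π σ))) 1
           (subst (Rises bits) (sym (Vecₚ.toList-map (lookup σ) π)))
           (subst (Rises bits) (Vecₚ.toList-map (lookup σ) π))) ⟩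
    ∑[ σ ∈ allVecs m n ] [ Rises? bits (toList (σ∘π σ)) ]· 1
      ≡⟨ ∑-allVecs-bijection m n σ∘π f∘π⁻¹ f∘π⁻¹∘π σ∘π∘π⁻¹ (λ f → [ Rises? bits (toList f) ]· 1) ⟩
    ∑[ f ∈ allVecs m n ] [ Rises? bits (toList f) ]· 1
      ≡⟨ count-Rises m n bits (length-δs D π) (δs≤1 D (toList π)) ⟩
    (m + sum bits) C n
      ≡⟨ cong (λ d → (m + d) C n) (sym (δList≡sum-δs D (toList π))) ⟩
    (m + δVec D π) C n ∎
    where
    open ≡-Reasoning
    bits = δs D (toList π)
    π⁻¹ : Fin n → Fin n
    π⁻¹ u = proj₁ (injective⇒surjective (lookup π) (distinct _ _) u)
    π∘π⁻¹ : ∀ u → lookup π (π⁻¹ u) ≡ u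
    π∘π⁻¹ u = proj₂ (injective⇒surjective (lookup π) (distinct _ _) u)
    σ∘π : Vec (Fin m) n → Vec (Fin m) n
    σ∘π σ = Vec.map (lookup σ) π
    f∘π⁻¹ : Vec (Fin m) n → Vec (Fin m) n
    f∘π⁻¹ f = tabulate (lookup f ∘ π⁻¹)
    f∘π⁻¹∘π : ∀ σ → f∘π⁻¹ (σ∘π σ) ≡ σ
    f∘π⁻¹∘π σ = lookup-ext _ σ λ u → begin
      lookup (f∘π⁻¹ (σ∘π σ)) u       ≡⟨ Vecₚ.lookup∘tabulate _ u ⟩
      lookup (σ∘π σ) (π⁻¹ u)         ≡⟨ Vecₚ.lookup-map (π⁻¹ u) (lookup σ) π ⟩
      lookup σ (lookup π (π⁻¹ u))    ≡⟨ cong (lookup σ) (π∘π⁻¹ u) ⟩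
      lookup σ u                     ∎
    σ∘π∘π⁻¹ : ∀ f → σ∘π (f∘π⁻¹ f) ≡ f
    σ∘π∘π⁻¹ f = lookup-ext _ f λ i → begin
      lookup (σ∘π (f∘π⁻¹ f)) i       ≡⟨ Vecₚ.lookup-map i (lookup (f∘π⁻¹ f)) π ⟩
      lookup (f∘π⁻¹ f) (lookup π i)  ≡⟨ Vecₚ.lookup∘tabulate _ (lookup π i) ⟩
      lookup f (π⁻¹ (lookup π i))    ≡⟨ cong (lookup f) (distinct _ _ (π∘π⁻¹ (lookup π i))) ⟩
      lookup f i                     ∎

  Ω≡Ψ : ∑[ σ ∈ allVecs m n ] [ OrderPreserving? σ ]· 1
        ≡ ∑[ π ∈ allVecs n n ] [ IsOP? π ]· ((m + δVec D π) C n)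
  Ω≡Ψ = begin
    ∑[ σ ∈ allVecs m n ] [ OrderPreserving? σ ]· 1
      ≡⟨ ∑-cong (allVecs m n) OrderPreserving-as-∑ ⟩
    ∑[ σ ∈ allVecs m n ] ∑[ π ∈ allVecs n n ] [ IsOP? π ]· [ Compatible? σ π ]· 1
      ≡⟨ ∑-swap (allVecs m n) (allVecs n n) _ ⟩
    ∑[ π ∈ allVecs n n ] ∑[ σ ∈ allVecs m n ] [ IsOP? π ]· [ Compatible? σ π ]· 1
      ≡⟨ ∑-cong (allVecs n n) compatible-count ⟩
    ∑[ π ∈ allVecs n n ] [ IsOP? π ]· ((m + δVec D π) C n) ∎
    where open ≡-Reasoning

theorem1p3 : (n : ℕ) (D : Digraph n) → Acyclic D → WEmpty D →
    (m : ℕ) → 1 ≤ m → Σ ℕ (λ s → PsiIs D m s × OmegaIs D m s)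
theorem1p3 n D acyclic wempty m _ =
  _ , WSum-∑ IsOP? (λ π → (m + δVec D π) C n) (allVecs n n)
    , subst (OmegaIs D m) Ω≡Ψ (WSum-∑ OrderPreserving? (λ _ → 1) (allVecs m n))
  where open Counting D acyclic wempty {m}
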